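{- For any $k\geq 1$ and $n\geq k+1$, $$p_{n;=n-k}=p_{n;=n-k+1}+\binom{n}{k+1}(n-k)^{n-k-2}-\sum_{i=1}^k\binom{n}{i}p_{n-i;=n-k},$$ and $p_{n;=n}=n^{n-1}$ for $n\ge 1$.
   Context: There are $n$ parking spaces in a line numbered $1,\dots,n$; $n$ cars arrive in order, car $j$ has preference $a_j\in[n]$ and parks in the first unoccupied space numbered $\geq a_j$, if any; $(a_1,\dots,a_n)$ is a parking function if all cars park. $p_{n;=s}$ is the number of parking functions of length $n$ with all $a_j\leq s$ and $a_j=s$ for some $j$. -}

module Defs where

open import Data.Nat using (ℕ; zero; suc; _+_; _≤ᵇ_; _≡ᵇ_)
open import Data.Bool using (Bool; true; false; _∧_; if_then_else_)
open import Data.Maybe using (Maybe; just; nothing)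
open import Data.List using (List; []; _∷_; length; map; concatMap; filter)
open import Data.Bool.ListAction using (all; any)
open import Data.List.Base using (upTo)
open import Relation.Nullary.Decidable using (does)
open import Data.Bool using (T?)

oneTo : ℕ → List ℕ
oneTo s = map suc (upTo s)

seqs : ℕ → ℕ → List (List ℕ)
seqs zero    s = [] ∷ []
seqs (suc m) s = concatMap (λ a → map (a ∷_) (seqs m s)) (oneTo s)

occupied : ℕ → List ℕ → Bool
occupied p occ = any (λ q → p ≡ᵇ q) occ

findSpot : (n a fuel : ℕ) → List ℕ → Maybe ℕ
findSpot n a zero       occ = nothing
findSpot n a (suc fuel) occ =
  if a ≤ᵇ n
  then (if occupied a occ then findSpot n (suc a) fuel occ else just a)
  else nothing

-- Cars arrive in order with the given preferences; each parks in the first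
-- unoccupied space ≥ its preference among 1..n.  Returns true iff all cars park.
parkAll : (n : ℕ) → List ℕ → List ℕ → Bool
parkAll n occ []       = true
parkAll n occ (a ∷ as) with findSpot n a n occ
... | just p  = parkAll n (p ∷ occ) as
... | nothing = false

isParkingFunction : (n : ℕ) → List ℕ → Bool
isParkingFunction n as = parkAll n [] as

-- p_{n;=s}: number of parking functions of length n (entries in [n]) with all
-- a_j ≤ s and a_j = s for some j.
pEq : ℕ → ℕ → ℕ
pEq n s = length (filter (λ as → T? (isParkingFunction n as
                                     ∧ all (λ a → a ≤ᵇ s) as
                                     ∧ any (λ a → a ≡ᵇ s) as))
                         (seqs n n))

module Submission where

-- The proof runs entirely through explicit counting sums over [1, t]^m.
--  * Parking criterion: the simulation in Defs succeeds iff for every j at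
--    most n ∸ j cars prefer a space > j (an invariant of the parking process).
--  * Removing the maximum: a sequence in [1, s+1]^n with i entries s+1 is a
--    parking function using s+1 iff 1 ≤ i ≤ n ∸ s and its other entries form
--    a parking function of length n ∸ i.  Summing over the C(n, i) positions
--    of those entries gives  p_{n;=s+1} = Σ_{j < n∸s} C(n, j+1) · f(n-j-1, s),
--    where f(m, t) counts parking functions of length m with entries ≤ t.
--  * Cayley's formula f(m, m) = (m+1)^(m-1), by Pollak's cycle lemma: of the
--    m+1 cyclic rotations of a sequence in [1, m+1]^m exactly one parks.
--  * Finally f(m, s) = p_{m;=s} + f(m, s-1), and comparing the expansions of
--    p_{n;=s} and p_{n;=s+1} for s = n ∸ k yields the corollary.

open import Defs

open import Data.Bool using (Bool; true; false; _∧_; _∨_; not; T; T?; if_then_else_)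
open import Data.Bool.ListAction using (all; any)
open import Data.Bool.Properties using (T-∧)
open import Data.Empty using (⊥; ⊥-elim)
open import Data.List using (List; []; _∷_; length; map; concatMap; filter; _++_; upTo; applyUpTo)
open import Data.List.Properties using (upTo-∷ʳ; map-++; length-map)
open import Data.List.Relation.Unary.All as All using (All; []; _∷_)
open import Data.List.Relation.Unary.All.Properties using () renaming (map⁺ to All-map⁺)
open import Data.Maybe using (just; nothing)
open import Data.Nat using (ℕ; zero; suc; _+_; _*_; _∸_; _^_; _≤_; _<_; z≤n; s≤s; _≤ᵇ_; _<ᵇ_; _≡ᵇ_; _≤?_; _<?_)
open import Data.Nat.Combinatorics using (_C_; k>n⇒nCk≡0; nCk+nC[k+1]≡[n+1]C[k+1]; nC1≡n)
open import Data.Nat.ListAction using (sum)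
open import Data.Nat.ListAction.Properties using (sum-++)
open import Data.Nat.Properties
open import Data.Nat.Tactic.RingSolver using (solve-∀)
open import Data.Product using (Σ; _×_; _,_; proj₁; proj₂)
open import Data.Sum using (_⊎_; inj₁; inj₂)
open import Data.Unit using (tt)
open import Function.Bundles using (Equivalence)
open import Relation.Binary.PropositionalEquality
open import Relation.Nullary using (¬_; yes; no)
open import Relation.Nullary.Reflects using (ofʸ; ofⁿ)

open import Algebra.Properties.CommutativeSemigroup +-commutativeSemigroup
  using () renaming (interchange to +-interchange)

𝟙 : Bool → ℕ
𝟙 true  = 1
𝟙 false = 0

data ≤ᵇ-View (m n : ℕ) : Bool → Set where
  le : m ≤ n → ≤ᵇ-View m n true
  gt : n < m → ≤ᵇ-View m n false

≤ᵇ-view : ∀ m n → ≤ᵇ-View m n (m ≤ᵇ n)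
≤ᵇ-view m n with m ≤ᵇ n | ≤ᵇ-reflects-≤ m n
... | true  | ofʸ m≤n = le m≤n
... | false | ofⁿ m≰n = gt (≰⇒> m≰n)

data <ᵇ-View (m n : ℕ) : Bool → Set where
  lt : m < n → <ᵇ-View m n true
  ge : n ≤ m → <ᵇ-View m n false

<ᵇ-view : ∀ m n → <ᵇ-View m n (m <ᵇ n)
<ᵇ-view m n with m <ᵇ n | <ᵇ-reflects-< m n
... | true  | ofʸ m<n = lt m<n
... | false | ofⁿ m≮n = ge (≮⇒≥ m≮n)

data ≡ᵇ-View (m n : ℕ) : Bool → Set where
  eq : m ≡ n → ≡ᵇ-View m n true
  ne : m ≢ n → ≡ᵇ-View m n false

≡ᵇ-view : ∀ m n → ≡ᵇ-View m n (m ≡ᵇ n)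
≡ᵇ-view m n with m ≡ᵇ n in e
... | true  = eq (≡ᵇ⇒≡ m n (subst T (sym e) tt))
... | false = ne λ m≡n → subst T e (≡⇒≡ᵇ m n m≡n)

𝟙-≤ᵇ-yes : ∀ {m n} → m ≤ n → 𝟙 (m ≤ᵇ n) ≡ 1
𝟙-≤ᵇ-yes {m} {n} m≤n with m ≤ᵇ n | ≤ᵇ-view m n
... | true  | le _   = refl
... | false | gt n<m = ⊥-elim (<⇒≱ n<m m≤n)

𝟙-≤ᵇ-no : ∀ {m n} → n < m → 𝟙 (m ≤ᵇ n) ≡ 0
𝟙-≤ᵇ-no {m} {n} n<m with m ≤ᵇ n | ≤ᵇ-view m n
... | true  | le m≤n = ⊥-elim (<⇒≱ n<m m≤n)
... | false | gt _   = refl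

-- Since  m <ᵇ n  is  suc m ≤ᵇ n  by definition, these cover _<ᵇ_ as well.
𝟙-<ᵇ-yes : ∀ {m n} → m < n → 𝟙 (m <ᵇ n) ≡ 1
𝟙-<ᵇ-yes = 𝟙-≤ᵇ-yes

𝟙-<ᵇ-no : ∀ {m n} → n ≤ m → 𝟙 (m <ᵇ n) ≡ 0
𝟙-<ᵇ-no n≤m = 𝟙-≤ᵇ-no (s≤s n≤m)

𝟙-≤ᵇ-cong : ∀ {m n m' n'} → (m ≤ n → m' ≤ n') → (m' ≤ n' → m ≤ n) →
            𝟙 (m ≤ᵇ n) ≡ 𝟙 (m' ≤ᵇ n')
𝟙-≤ᵇ-cong {m} {n} to from with m ≤ᵇ n | ≤ᵇ-view m n
... | true  | le m≤n = sym (𝟙-≤ᵇ-yes (to m≤n))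
... | false | gt n<m = sym (𝟙-≤ᵇ-no (≰⇒> λ m'≤n' → <⇒≱ n<m (from m'≤n')))

𝟙-∧ : ∀ x y → 𝟙 (x ∧ y) ≡ 𝟙 x * 𝟙 y
𝟙-∧ true  y = sym (+-identityʳ (𝟙 y))
𝟙-∧ false y = refl

T-ext : ∀ {b c : Bool} → (T b → T c) → (T c → T b) → b ≡ c
T-ext {true}  {true}  _ _ = refl
T-ext {true}  {false} f _ = ⊥-elim (f tt)
T-ext {false} {true}  _ g = ⊥-elim (g tt)
T-ext {false} {false} _ _ = refl

T-∧⁻ : ∀ {x y} → T (x ∧ y) → T x × T y
T-∧⁻ = Equivalence.to T-∧

T-∧⁺ : ∀ {x y} → T x × T y → T (x ∧ y)
T-∧⁺ = Equivalence.from T-∧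

-- Finite sums.  sumTo f n = f 1 + ⋯ + f n  (the range of parking spaces and
-- of preferences), and  sumBelow f k = f 0 + ⋯ + f (k-1)  (binomial sums).
sumTo : (ℕ → ℕ) → ℕ → ℕ
sumTo f zero    = 0
sumTo f (suc n) = sumTo f n + f (suc n)

sumBelow : (ℕ → ℕ) → ℕ → ℕ
sumBelow f zero    = 0
sumBelow f (suc k) = f 0 + sumBelow (λ i → f (suc i)) k

sumTo-cong : ∀ {f g} n → (∀ q → 1 ≤ q → q ≤ n → f q ≡ g q) → sumTo f n ≡ sumTo g n
sumTo-cong zero    f≗g = refl
sumTo-cong (suc n) f≗g =
  cong₂ _+_ (sumTo-cong n λ q 1≤q q≤n → f≗g q 1≤q (m≤n⇒m≤1+n q≤n)) (f≗g (suc n) (s≤s z≤n) ≤-refl)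

sumTo-+ : ∀ f g n → sumTo f n + sumTo g n ≡ sumTo (λ q → f q + g q) n
sumTo-+ f g zero    = refl
sumTo-+ f g (suc n) =
  trans (+-interchange (sumTo f n) (f (suc n)) (sumTo g n) (g (suc n)))
        (cong (_+ (f (suc n) + g (suc n))) (sumTo-+ f g n))

sumTo-* : ∀ c f n → c * sumTo f n ≡ sumTo (λ q → c * f q) n
sumTo-* c f zero    = *-zeroʳ c
sumTo-* c f (suc n) =
  trans (*-distribˡ-+ c (sumTo f n) (f (suc n))) (cong (_+ c * f (suc n)) (sumTo-* c f n))

sumTo-zero : ∀ {f} n → (∀ q → 1 ≤ q → q ≤ n → f q ≡ 0) → sumTo f n ≡ 0
sumTo-zero n f≗0 = trans (sumTo-cong n f≗0) (sumTo-0 n)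
  where
  sumTo-0 : ∀ n → sumTo (λ _ → 0) n ≡ 0
  sumTo-0 zero    = refl
  sumTo-0 (suc n) = cong (_+ 0) (sumTo-0 n)

sumTo-const : ∀ c n → sumTo (λ _ → c) n ≡ n * c
sumTo-const c zero    = refl
sumTo-const c (suc n) = trans (cong (_+ c) (sumTo-const c n)) (+-comm (n * c) c)

sumTo-delta : ∀ (b : ℕ → Bool) p n → 1 ≤ p → p ≤ n →
              sumTo (λ q → 𝟙 ((q ≡ᵇ p) ∧ b q)) n ≡ 𝟙 (b p)
sumTo-delta b .zero zero    ()  z≤n
sumTo-delta b p    (suc n) 1≤p p≤1+n with suc n ≡ᵇ p | ≡ᵇ-view (suc n) p
... | true  | eq refl = cong (_+ 𝟙 (b (suc n))) (sumTo-zero n λ q _ q≤n → off q q≤n)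
  where
  off : ∀ q → q ≤ n → 𝟙 ((q ≡ᵇ suc n) ∧ b q) ≡ 0
  off q q≤n with q ≡ᵇ suc n | ≡ᵇ-view q (suc n)
  ... | true  | eq refl = ⊥-elim (<-irrefl refl (s≤s q≤n))
  ... | false | ne _    = refl
... | false | ne 1+n≢p =
  trans (+-identityʳ _) (sumTo-delta b p n 1≤p (≤-pred (≤∧≢⇒< p≤1+n (≢-sym 1+n≢p))))

sumTo-restrict : ∀ t N h → t ≤ N → sumTo (λ a → 𝟙 (a ≤ᵇ t) * h a) N ≡ sumTo h t
sumTo-restrict t zero    h z≤n = refl
sumTo-restrict t (suc N) h t≤1+N with suc N ≤ᵇ t | ≤ᵇ-view (suc N) t
... | true  | le 1+N≤t rewrite ≤-antisym t≤1+N 1+N≤t =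
  cong₂ _+_ (sumTo-cong N λ q _ q≤N →
              trans (cong (_* h q) (𝟙-≤ᵇ-yes (m≤n⇒m≤1+n q≤N))) (+-identityʳ (h q)))
            (+-identityʳ _)
... | false | gt t<1+N = trans (+-identityʳ _) (sumTo-restrict t N h (≤-pred t<1+N))

sumTo-split : ∀ h p q → sumTo h (p + q) ≡ sumTo h p + sumTo (λ u → h (p + u)) q
sumTo-split h p zero    = trans (cong (sumTo h) (+-identityʳ p)) (sym (+-identityʳ _))
sumTo-split h p (suc q) = begin
    sumTo h (p + suc q)
  ≡⟨ cong (sumTo h) (+-suc p q) ⟩
    sumTo h (p + q) + h (suc (p + q))
  ≡⟨ cong (_+ h (suc (p + q))) (sumTo-split h p q) ⟩
    (sumTo h p + sumTo (λ u → h (p + u)) q) + h (suc (p + q))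
  ≡⟨ +-assoc (sumTo h p) _ _ ⟩
    sumTo h p + (sumTo (λ u → h (p + u)) q + h (suc (p + q)))
  ≡⟨ cong (λ z → sumTo h p + (sumTo (λ u → h (p + u)) q + h z)) (sym (+-suc p q)) ⟩
    sumTo h p + sumTo (λ u → h (p + u)) (suc q)
  ∎
  where open ≡-Reasoning

sumBelow-cong : ∀ {f g} k → (∀ i → i < k → f i ≡ g i) → sumBelow f k ≡ sumBelow g k
sumBelow-cong zero    f≗g = refl
sumBelow-cong (suc k) f≗g = cong₂ _+_ (f≗g 0 (s≤s z≤n)) (sumBelow-cong k λ i i<k → f≗g (suc i) (s≤s i<k))

sumBelow-snoc : ∀ f k → sumBelow f (suc k) ≡ sumBelow f k + f k
sumBelow-snoc f zero    = +-comm (f 0) 0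
sumBelow-snoc f (suc k) =
  trans (cong (f 0 +_) (sumBelow-snoc (λ i → f (suc i)) k)) (sym (+-assoc (f 0) _ _))

sumBelow-+ : ∀ f g k → sumBelow f k + sumBelow g k ≡ sumBelow (λ i → f i + g i) k
sumBelow-+ f g zero    = refl
sumBelow-+ f g (suc k) =
  trans (+-interchange (f 0) _ (g 0) _) (cong (f 0 + g 0 +_) (sumBelow-+ _ _ k))

sumBelow-sumTo : ∀ (g : ℕ → ℕ → ℕ) k s →
                 sumBelow (λ i → sumTo (g i) s) k ≡ sumTo (λ a → sumBelow (λ i → g i a) k) s
sumBelow-sumTo g zero    s = sym (sumTo-zero s λ _ _ _ → refl)
sumBelow-sumTo g (suc k) s =
  trans (cong (sumTo (g 0) s +_) (sumBelow-sumTo (λ i → g (suc i)) k s)) (sumTo-+ _ _ s)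

sumBelow-restrict : ∀ k n (g : ℕ → ℕ) → k ≤ n → sumBelow (λ j → 𝟙 (suc j ≤ᵇ k) * g j) n ≡ sumBelow g k
sumBelow-restrict zero    n       g _         = sumBelow-0 n
  where
  sumBelow-0 : ∀ n → sumBelow (λ _ → 0) n ≡ 0
  sumBelow-0 zero    = refl
  sumBelow-0 (suc n) = sumBelow-0 n
sumBelow-restrict (suc k) (suc n) g (s≤s k≤n) =
  cong₂ _+_ (+-identityʳ (g 0)) (sumBelow-restrict k n (λ j → g (suc j)) k≤n)

sumOver : ∀ {A : Set} → List A → (A → ℕ) → ℕ
sumOver xs w = sum (map w xs)

sumSeqs : ℕ → ℕ → (List ℕ → ℕ) → ℕ
sumSeqs m N w = sumOver (seqs m N) w

length-filter : ∀ {A : Set} (b : A → Bool) xs →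
                length (filter (λ x → T? (b x)) xs) ≡ sumOver xs (λ x → 𝟙 (b x))
length-filter b []       = refl
length-filter b (x ∷ xs) with b x
... | true  = cong suc (length-filter b xs)
... | false = length-filter b xs

sumOver-++ : ∀ {A : Set} (xs ys : List A) w → sumOver (xs ++ ys) w ≡ sumOver xs w + sumOver ys w
sumOver-++ xs ys w = trans (cong sum (map-++ w xs ys)) (sum-++ (map w xs) (map w ys))

sumOver-map : ∀ {A B : Set} (f : A → B) xs w → sumOver (map f xs) w ≡ sumOver xs (λ x → w (f x))
sumOver-map f []       w = refl
sumOver-map f (x ∷ xs) w = cong (w (f x) +_) (sumOver-map f xs w)

sumOver-concatMap : ∀ {A B : Set} (f : A → List B) xs w →
                    sumOver (concatMap f xs) w ≡ sumOver xs (λ x → sumOver (f x) w)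
sumOver-concatMap f []       w = refl
sumOver-concatMap f (x ∷ xs) w =
  trans (sumOver-++ (f x) (concatMap f xs) w) (cong (sumOver (f x) w +_) (sumOver-concatMap f xs w))

sumOver-+ : ∀ {A : Set} (xs : List A) f g → sumOver xs f + sumOver xs g ≡ sumOver xs (λ x → f x + g x)
sumOver-+ []       f g = refl
sumOver-+ (x ∷ xs) f g =
  trans (+-interchange (f x) (sumOver xs f) (g x) (sumOver xs g)) (cong (f x + g x +_) (sumOver-+ xs f g))

sumOver-* : ∀ {A : Set} (xs : List A) c f → c * sumOver xs f ≡ sumOver xs (λ x → c * f x)
sumOver-* []       c f = *-zeroʳ c
sumOver-* (x ∷ xs) c f = trans (*-distribˡ-+ c (f x) (sumOver xs f)) (cong (c * f x +_) (sumOver-* xs c f))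

sumOver-sumTo : ∀ {A : Set} (xs : List A) (g : ℕ → A → ℕ) K →
                sumOver xs (λ x → sumTo (λ r → g r x) K) ≡ sumTo (λ r → sumOver xs (g r)) K
sumOver-sumTo xs g zero    = sumOver-0 xs
  where
  sumOver-0 : ∀ xs → sumOver xs (λ _ → 0) ≡ 0
  sumOver-0 []       = refl
  sumOver-0 (x ∷ xs) = sumOver-0 xs
sumOver-sumTo xs g (suc K) =
  trans (sym (sumOver-+ xs _ _)) (cong (_+ sumOver xs (g (suc K))) (sumOver-sumTo xs g K))

sumOver-oneTo : ∀ n f → sumOver (oneTo n) f ≡ sumTo f n
sumOver-oneTo zero    f = refl
sumOver-oneTo (suc n) f = begin
    sumOver (map suc (upTo (suc n))) f
  ≡⟨ cong (λ l → sumOver (map suc l) f) (sym (upTo-∷ʳ n)) ⟩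
    sumOver (map suc (upTo n ++ n ∷ [])) f
  ≡⟨ cong (λ l → sumOver l f) (map-++ suc (upTo n) (n ∷ [])) ⟩
    sumOver (oneTo n ++ suc n ∷ []) f
  ≡⟨ sumOver-++ (oneTo n) (suc n ∷ []) f ⟩
    sumOver (oneTo n) f + (f (suc n) + 0)
  ≡⟨ cong₂ _+_ (sumOver-oneTo n f) (+-identityʳ _) ⟩
    sumTo f n + f (suc n)
  ∎
  where open ≡-Reasoning

sumSeqs-suc : ∀ m N w → sumSeqs (suc m) N w ≡ sumTo (λ a → sumSeqs m N (λ as → w (a ∷ as))) N
sumSeqs-suc m N w =
  trans (sumOver-concatMap (λ a → map (a ∷_) (seqs m N)) (oneTo N) w)
        (trans (sumOver-oneTo N _) (sumTo-cong N λ a _ _ → sumOver-map (a ∷_) (seqs m N) w))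

InSeqs : ℕ → ℕ → List ℕ → Set
InSeqs m N as = (length as ≡ m) × All (λ a → (1 ≤ a) × (a ≤ N)) as

sumSeqs-cong : ∀ m N {f g} → (∀ as → InSeqs m N as → f as ≡ g as) → sumSeqs m N f ≡ sumSeqs m N g
sumSeqs-cong zero    N f≗g = cong (_+ 0) (f≗g [] (refl , []))
sumSeqs-cong (suc m) N {f} {g} f≗g =
  trans (sumSeqs-suc m N f)
    (trans (sumTo-cong N λ a 1≤a a≤N → sumSeqs-cong m N λ as (len , bounds) →
              f≗g (a ∷ as) (cong suc len , (1≤a , a≤N) ∷ bounds))
           (sym (sumSeqs-suc m N g)))

sumSeqs-one : ∀ m N → sumSeqs m N (λ _ → 1) ≡ N ^ m
sumSeqs-one zero    N = refl
sumSeqs-one (suc m) N =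
  trans (sumSeqs-suc m N _) (trans (sumTo-cong N λ a _ _ → sumSeqs-one m N) (sumTo-const (N ^ m) N))

sumSeqs-restrict : ∀ m N t w → t ≤ N →
                   sumSeqs m N (λ as → 𝟙 (all (λ a → a ≤ᵇ t) as) * w as) ≡ sumSeqs m t w
sumSeqs-restrict zero    N t w t≤N = cong (_+ 0) (+-identityʳ _)
sumSeqs-restrict (suc m) N t w t≤N =
  trans (sumSeqs-suc m N _)
    (trans (sumTo-cong N λ a _ _ → head a)
      (trans (sumTo-restrict t N _ t≤N) (sym (sumSeqs-suc m t w))))
  where
  head : ∀ a → sumSeqs m N (λ as → 𝟙 ((a ≤ᵇ t) ∧ all (λ a → a ≤ᵇ t) as) * w (a ∷ as))
             ≡ 𝟙 (a ≤ᵇ t) * sumSeqs m t (λ as → w (a ∷ as))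
  head a =
    trans (sumSeqs-cong m N λ as _ → trans (cong (_* w (a ∷ as)) (𝟙-∧ (a ≤ᵇ t) _)) (*-assoc (𝟙 (a ≤ᵇ t)) _ _))
      (trans (sym (sumOver-* (seqs m N) (𝟙 (a ≤ᵇ t)) _))
             (cong (𝟙 (a ≤ᵇ t) *_) (sumSeqs-restrict m N t (λ as → w (a ∷ as)) t≤N)))

countGe : ℕ → List ℕ → ℕ
countGe j []       = 0
countGe j (a ∷ as) = 𝟙 (j ≤ᵇ a) + countGe j as

countGe-antitone : ∀ {j j'} as → j ≤ j' → countGe j' as ≤ countGe j as
countGe-antitone []       j≤j' = z≤n
countGe-antitone {j} {j'} (a ∷ as) j≤j' =
  +-mono-≤ (head (j' ≤ᵇ a) (j ≤ᵇ a) (≤ᵇ-view j' a) (≤ᵇ-view j a)) (countGe-antitone as j≤j')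
  where
  head : ∀ b c → ≤ᵇ-View j' a b → ≤ᵇ-View j a c → 𝟙 b ≤ 𝟙 c
  head .true  .true  (le _)     (le _)   = ≤-refl
  head .true  .false (le j'≤a)  (gt a<j) = ⊥-elim (<⇒≱ a<j (≤-trans j≤j' j'≤a))
  head .false _      (gt _)     _        = z≤n

-- The parking process on spaces [1, n].  free j occ  counts the unoccupied
-- spaces in (j, n].  The invariant  Fits occ as  says that for every
-- threshold j, the cars still to come that prefer a space > j are at most
-- the free spaces > j; it holds exactly when all of those cars can park.
module Parking (n : ℕ) where

  free : ℕ → List ℕ → ℕ
  free j occ = sumTo (λ q → 𝟙 ((j <ᵇ q) ∧ not (occupied q occ))) n

  Fits : List ℕ → List ℕ → Set
  Fits occ as = ∀ j → j ≤ n → countGe (suc j) as ≤ free j occ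

  findSpot-just : ∀ a fuel occ p → findSpot n a fuel occ ≡ just p →
    (a ≤ p) × (p ≤ n) × (occupied p occ ≡ false) × (∀ q → a ≤ q → q < p → occupied q occ ≡ true)
  findSpot-just a zero       occ p ()
  findSpot-just a (suc fuel) occ p found with a ≤ᵇ n | ≤ᵇ-view a n
  ... | false | gt _   with found
  ...   | ()
  findSpot-just a (suc fuel) occ p found | true | le a≤n with occupied a occ in a-occ
  ... | false with found
  ...   | refl = ≤-refl , a≤n , a-occ , λ q a≤q q<a → ⊥-elim (<⇒≱ q<a a≤q)
  findSpot-just a (suc fuel) occ p found | true | le a≤n | true
    with findSpot-just (suc a) fuel occ p found
  ... | a<p , p≤n , p-free , between = <⇒≤ a<p , p≤n , p-free , before
    where
    before : ∀ q → a ≤ q → q < p → occupied q occ ≡ true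
    before q a≤q q<p with q ≟ a
    ... | yes refl = a-occ
    ... | no  q≢a  = between q (≤∧≢⇒< a≤q (≢-sym q≢a)) q<p

  findSpot-nothing : ∀ a fuel occ → n < a + fuel → findSpot n a fuel occ ≡ nothing →
                     ∀ q → a ≤ q → q ≤ n → occupied q occ ≡ true
  findSpot-nothing a zero occ n<a+0 _ q a≤q q≤n =
    ⊥-elim (<⇒≱ (subst (n <_) (+-identityʳ a) n<a+0) (≤-trans a≤q q≤n))
  findSpot-nothing a (suc fuel) occ n<a+fuel none q a≤q q≤n with a ≤ᵇ n | ≤ᵇ-view a n
  ... | false | gt n<a = ⊥-elim (<⇒≱ n<a (≤-trans a≤q q≤n))
  ... | true  | le _ with occupied a occ in a-occ
  ...   | false with none
  ...     | ()
  findSpot-nothing a (suc fuel) occ n<a+fuel none q a≤q q≤n | true | le _ | true with q ≟ a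
  ... | yes refl = a-occ
  ... | no  q≢a  = findSpot-nothing (suc a) fuel occ (subst (n <_) (+-suc a fuel) n<a+fuel) none
                                    q (≤∧≢⇒< a≤q (≢-sym q≢a)) q≤n

  free-occupy : ∀ j p occ → occupied p occ ≡ false → 1 ≤ p → p ≤ n →
                free j (p ∷ occ) + 𝟙 (j <ᵇ p) ≡ free j occ
  free-occupy j p occ p-free 1≤p p≤n =
    trans (cong (free j (p ∷ occ) +_) (sym (sumTo-delta (j <ᵇ_) p n 1≤p p≤n)))
      (trans (sumTo-+ _ _ n) (sumTo-cong n λ q _ _ → pointwise q))
    where
    pointwise : ∀ q → 𝟙 ((j <ᵇ q) ∧ not ((q ≡ᵇ p) ∨ occupied q occ)) + 𝟙 ((q ≡ᵇ p) ∧ (j <ᵇ q))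
                      ≡ 𝟙 ((j <ᵇ q) ∧ not (occupied q occ))
    pointwise q with q ≡ᵇ p | ≡ᵇ-view q p
    ... | true  | eq refl rewrite p-free with j <ᵇ q
    ...   | true  = refl
    ...   | false = refl
    pointwise q | false | ne _ = +-identityʳ _

  free-skip : ∀ j j' occ → j ≤ j' → (∀ q → j < q → q ≤ j' → occupied q occ ≡ true) →
              free j occ ≡ free j' occ
  free-skip j j' occ j≤j' taken = sumTo-cong n λ q _ _ → pointwise q
    where
    pointwise : ∀ q → 𝟙 ((j <ᵇ q) ∧ not (occupied q occ)) ≡ 𝟙 ((j' <ᵇ q) ∧ not (occupied q occ))
    pointwise q with j' <ᵇ q | <ᵇ-view j' q | j <ᵇ q | <ᵇ-view j q
    ... | true  | lt _    | true  | lt _   = refl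
    ... | true  | lt j'<q | false | ge q≤j = ⊥-elim (<⇒≱ j'<q (≤-trans q≤j j≤j'))
    ... | false | ge q≤j' | true  | lt j<q rewrite taken q j<q q≤j' = refl
    ... | false | ge _    | false | ge _   = refl

  free-full : ∀ j occ → (∀ q → j < q → q ≤ n → occupied q occ ≡ true) → free j occ ≡ 0
  free-full j occ taken = sumTo-zero n λ q _ q≤n → pointwise q q≤n
    where
    pointwise : ∀ q → q ≤ n → 𝟙 ((j <ᵇ q) ∧ not (occupied q occ)) ≡ 0
    pointwise q q≤n with j <ᵇ q | <ᵇ-view j q
    ... | true  | lt j<q rewrite taken q j<q q≤n = refl
    ... | false | ge _   = refl

  blocked : ∀ j a occ as → j ≤ n → j < a → (∀ q → j < q → q ≤ n → occupied q occ ≡ true) →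
            ¬ Fits occ (a ∷ as)
  blocked j a occ as j≤n j<a taken fits
    with subst₂ _≤_ (cong (_+ countGe (suc j) as) (𝟙-≤ᵇ-yes j<a)) (free-full j occ taken) (fits j j≤n)
  ... | ()

  stuck⇒¬Fits : ∀ a occ as → 1 ≤ a → (∀ q → a ≤ q → q ≤ n → occupied q occ ≡ true) → ¬ Fits occ (a ∷ as)
  stuck⇒¬Fits (suc a) occ as _ taken with a ≤? n
  ... | yes a≤n = blocked a (suc a) occ as a≤n ≤-refl taken
  ... | no  a≰n = blocked n (suc a) occ as ≤-refl (s≤s (<⇒≤ (≰⇒> a≰n))) λ q n<q q≤n → ⊥-elim (<⇒≱ n<q q≤n)

  SpotFor : ℕ → List ℕ → ℕ → Set
  SpotFor a occ p = (a ≤ p) × (p ≤ n) × (occupied p occ ≡ false) × (∀ q → a ≤ q → q < p → occupied q occ ≡ true)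

  occupy-spot : ∀ {a} j p occ → 1 ≤ a → SpotFor a occ p → free j (p ∷ occ) + 𝟙 (j <ᵇ p) ≡ free j occ
  occupy-spot j p occ 1≤a (a≤p , p≤n , p-free , _) = free-occupy j p occ p-free (≤-trans 1≤a a≤p) p≤n

  fits-cons : ∀ a p occ as → 1 ≤ a → SpotFor a occ p → Fits (p ∷ occ) as → Fits occ (a ∷ as)
  fits-cons a p occ as 1≤a spot@(a≤p , _) fits j j≤n with suc j ≤ᵇ a | ≤ᵇ-view (suc j) a
  ... | true  | le j<a =
    subst (1 + countGe (suc j) as ≤_)
          (trans (cong (free j (p ∷ occ) +_) (sym (𝟙-<ᵇ-yes (≤-trans j<a a≤p)))) (occupy-spot j p occ 1≤a spot))
          (subst (_≤ free j (p ∷ occ) + 1) (+-comm (countGe (suc j) as) 1) (+-monoˡ-≤ 1 (fits j j≤n)))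
  ... | false | gt _ =
    ≤-trans (fits j j≤n) (subst (free j (p ∷ occ) ≤_) (occupy-spot j p occ 1≤a spot) (m≤m+n _ _))

  fits-uncons : ∀ a p occ as → 1 ≤ a → SpotFor a occ p → Fits occ (a ∷ as) → Fits (p ∷ occ) as
  fits-uncons a p occ as 1≤a spot@(a≤p , p≤n , _ , before) fits j j≤n with suc j ≤ᵇ a | ≤ᵇ-view (suc j) a
  ... | true  | le j<a =
    +-cancelʳ-≤ 1 _ _
      (subst (countGe (suc j) as + 1 ≤_)
             (trans (sym (occupy-spot j p occ 1≤a spot)) (cong (free j (p ∷ occ) +_) (𝟙-<ᵇ-yes (≤-trans j<a a≤p))))
             (subst (_≤ free j occ) (+-comm 1 (countGe (suc j) as))
                    (subst (λ c → c + countGe (suc j) as ≤ free j occ) (𝟙-≤ᵇ-yes j<a) (fits j j≤n))))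
  ... | false | gt a≤j with j <? p
  ...   | no  j≮p =
    subst (countGe (suc j) as ≤_)
          (trans (sym (occupy-spot j p occ 1≤a spot))
                 (trans (cong (free j (p ∷ occ) +_) (𝟙-<ᵇ-no (≮⇒≥ j≮p))) (+-identityʳ _)))
          (subst (λ c → c + countGe (suc j) as ≤ free j occ) (𝟙-≤ᵇ-no a≤j) (fits j j≤n))
  ...   | yes j<p = between a 1≤a a≤j a≤p before fits
    where
    -- a ≤ j < p: the spaces [a, j] are taken, so the threshold a - 1 sees the
    -- same free spaces as j, one of which car a itself used.
    between : ∀ b → 1 ≤ b → b < suc j → b ≤ p → (∀ q → b ≤ q → q < p → occupied q occ ≡ true) →
              Fits occ (b ∷ as) → countGe (suc j) as ≤ free j (p ∷ occ)
    between (suc b) _ b<1+j b<p taken fits-b =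
      ≤-trans (countGe-antitone as (≤-pred (m≤n⇒m≤1+n b<1+j)))
              (+-cancelʳ-≤ 1 _ _ (subst₂ _≤_ (+-comm 1 _) same fits-at-b))
      where
      fits-at-b : 1 + countGe (suc b) as ≤ free b occ
      fits-at-b = subst (λ c → c + countGe (suc b) as ≤ free b occ) (𝟙-≤ᵇ-yes (≤-refl {suc b}))
                        (fits-b b (≤-trans (n≤1+n b) (≤-trans b<p p≤n)))
      same : free b occ ≡ free j (p ∷ occ) + 1
      same = trans (free-skip b j occ (<⇒≤ (≤-pred b<1+j)) λ q b<q q≤j → taken q b<q (≤-<-trans q≤j j<p))
                   (trans (sym (occupy-spot j p occ 1≤a spot)) (cong (free j (p ∷ occ) +_) (𝟙-<ᵇ-yes j<p)))

  parkAll⇔Fits : ∀ occ as → All (1 ≤_) as →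
                 (T (parkAll n occ as) → Fits occ as) × (Fits occ as → T (parkAll n occ as))
  parkAll⇔Fits occ []       _           = (λ _ _ _ → z≤n) , (λ _ → tt)
  parkAll⇔Fits occ (a ∷ as) (1≤a ∷ 1≤as) with findSpot n a n occ in search
  ... | nothing = (λ ()) , λ fits → ⊥-elim (stuck⇒¬Fits a occ as 1≤a taken fits)
    where
    taken : ∀ q → a ≤ q → q ≤ n → occupied q occ ≡ true
    taken = findSpot-nothing a n occ (+-monoˡ-≤ n 1≤a) search
  ... | just p  =
    (λ parked → fits-cons a p occ as 1≤a spot (proj₁ rest parked)) ,
    (λ fits → proj₂ rest (fits-uncons a p occ as 1≤a spot fits))
    where
    spot : SpotFor a occ p
    spot = findSpot-just a n occ p search
    rest : (T (parkAll n (p ∷ occ) as) → Fits (p ∷ occ) as) × (Fits (p ∷ occ) as → T (parkAll n (p ∷ occ) as))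
    rest = parkAll⇔Fits (p ∷ occ) as 1≤as

free-empty : ∀ j n → Parking.free n j [] ≡ n ∸ j
free-empty j n = count n
  where
  count : ∀ m → sumTo (λ q → 𝟙 ((j <ᵇ q) ∧ true)) m ≡ m ∸ j
  count zero    = sym (0∸n≡0 j)
  count (suc m) with j <ᵇ suc m | <ᵇ-view j (suc m)
  ... | true  | lt j<1+m =
    trans (cong (_+ 1) (count m)) (trans (+-comm (m ∸ j) 1) (sym (+-∸-assoc 1 (≤-pred j<1+m))))
  ... | false | ge 1+m≤j =
    trans (+-identityʳ _) (trans (count m) (trans (m≤n⇒m∸n≡0 (≤-trans (n≤1+n m) 1+m≤j))
                                                   (sym (m≤n⇒m∸n≡0 1+m≤j))))

Criterion : ℕ → List ℕ → Set
Criterion n as = ∀ j → j ≤ n → countGe (suc j) as + j ≤ n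

-- The invariant with nothing parked is exactly the criterion.
parking-criterion : ∀ n as → All (1 ≤_) as →
                    (T (isParkingFunction n as) → Criterion n as) × (Criterion n as → T (isParkingFunction n as))
parking-criterion n as 1≤as =
  (λ pf j j≤n → m≤o∸n⇒m+n≤o _ j≤n (subst (_ ≤_) (free-empty j n) (proj₁ process pf j j≤n))) ,
  (λ crit → proj₂ process λ j j≤n → subst (_ ≤_) (sym (free-empty j n)) (m+n≤o⇒m≤o∸n _ (crit j j≤n)))
  where
  process : (T (parkAll n [] as) → Parking.Fits n [] as) × (Parking.Fits n [] as → T (parkAll n [] as))
  process = Parking.parkAll⇔Fits n [] as 1≤as

binomial-pascal : ∀ n (u : ℕ → ℕ) →
  sumBelow (λ i → (n C i) * u i) (suc n) + sumBelow (λ i → (n C i) * u (suc i)) (suc n)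
    ≡ sumBelow (λ i → (suc n C i) * u i) (suc (suc n))
binomial-pascal n u = begin
    sumBelow (λ i → (n C i) * u i) (suc n) + B
  ≡⟨ cong (_+ B) first ⟩
    (1 * u 0 + A) + B
  ≡⟨ +-assoc (1 * u 0) A B ⟩
    1 * u 0 + (A + B)
  ≡⟨ cong (1 * u 0 +_) (trans (sumBelow-+ (λ i → (n C suc i) * u (suc i)) (λ i → (n C i) * u (suc i)) (suc n))
                                      (sumBelow-cong (suc n) λ i _ → pascal i)) ⟩
    1 * u 0 + sumBelow (λ i → (suc n C suc i) * u (suc i)) (suc n)
  ∎
  where
  open ≡-Reasoning
  A B : ℕ
  A = sumBelow (λ i → (n C suc i) * u (suc i)) (suc n)
  B = sumBelow (λ i → (n C i) * u (suc i)) (suc n)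
  -- the extra term C(n, n+1) u_{n+1} vanishes
  first : sumBelow (λ i → (n C i) * u i) (suc n) ≡ 1 * u 0 + A
  first = cong (1 * u 0 +_) (sym (trans (sumBelow-snoc (λ i → (n C suc i) * u (suc i)) n)
                                        (trans (cong (λ c → sumBelow (λ i → (n C suc i) * u (suc i)) n + c * u (suc n)) (k>n⇒nCk≡0 (n<1+n n)))
                                               (+-identityʳ _))))
  pascal : ∀ i → (n C suc i) * u (suc i) + (n C i) * u (suc i) ≡ (suc n C suc i) * u (suc i)
  pascal i = trans (sym (*-distribʳ-+ (u (suc i)) (n C suc i) (n C i)))
                   (cong (_* u (suc i)) (trans (+-comm (n C suc i) (n C i)) (nCk+nC[k+1]≡[n+1]C[k+1] n i)))

countEq : ℕ → List ℕ → ℕ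
countEq v []       = 0
countEq v (a ∷ as) = 𝟙 (a ≡ᵇ v) + countEq v as

removeAll : ℕ → List ℕ → List ℕ
removeAll v []       = []
removeAll v (a ∷ as) = if a ≡ᵇ v then removeAll v as else a ∷ removeAll v as

≡ᵇ-refl : ∀ s → (s ≡ᵇ s) ≡ true
≡ᵇ-refl zero    = refl
≡ᵇ-refl (suc s) = ≡ᵇ-refl s

≡ᵇ-<-false : ∀ a s → a ≤ s → (a ≡ᵇ suc s) ≡ false
≡ᵇ-<-false a s a≤s with a ≡ᵇ suc s | ≡ᵇ-view a (suc s)
... | true  | eq refl = ⊥-elim (<-irrefl refl a≤s)
... | false | _       = refl

-- Sorting sequences in [1, s+1]^n by the number i of entries equal to s+1:
-- choose their C(n,i) positions, the rest form a sequence in [1, s]^(n-i).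
sumSeqs-byTopCount : ∀ n s (W : ℕ → List ℕ → ℕ) →
  sumSeqs n (suc s) (λ as → W (countEq (suc s) as) (removeAll (suc s) as))
    ≡ sumBelow (λ i → (n C i) * sumSeqs (n ∸ i) s (W i)) (suc n)
sumSeqs-byTopCount zero    s W = cong (_+ 0) (trans (sym (+-identityʳ _)) (sym (*-identityˡ _)))
sumSeqs-byTopCount (suc n) s W = begin
    sumSeqs (suc n) (suc s) L
  ≡⟨ sumSeqs-suc n (suc s) L ⟩
    sumTo (λ a → sumSeqs n (suc s) (λ as → L (a ∷ as))) s + sumSeqs n (suc s) (λ as → L (suc s ∷ as))
  ≡⟨ cong₂ _+_ (sumTo-cong s λ a _ a≤s → below a a≤s) top ⟩
    sumTo (λ a → sumBelow (λ i → (n C i) * sumSeqs (n ∸ i) s (λ bs → W i (a ∷ bs))) (suc n)) s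
      + sumBelow (λ i → (n C i) * u (suc i)) (suc n)
  ≡⟨ cong (_+ sumBelow (λ i → (n C i) * u (suc i)) (suc n)) regroup ⟩
    sumBelow (λ i → (n C i) * u i) (suc n) + sumBelow (λ i → (n C i) * u (suc i)) (suc n)
  ≡⟨ binomial-pascal n u ⟩
    sumBelow (λ i → (suc n C i) * u i) (suc (suc n))
  ∎
  where
  open ≡-Reasoning
  L : List ℕ → ℕ
  L as = W (countEq (suc s) as) (removeAll (suc s) as)
  u : ℕ → ℕ
  u i = sumSeqs (suc n ∸ i) s (W i)
  below : ∀ a → a ≤ s → sumSeqs n (suc s) (λ as → L (a ∷ as))
                        ≡ sumBelow (λ i → (n C i) * sumSeqs (n ∸ i) s (λ bs → W i (a ∷ bs))) (suc n)
  below a a≤s rewrite ≡ᵇ-<-false a s a≤s = sumSeqs-byTopCount n s (λ i bs → W i (a ∷ bs))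
  top : sumSeqs n (suc s) (λ as → L (suc s ∷ as)) ≡ sumBelow (λ i → (n C i) * u (suc i)) (suc n)
  top rewrite ≡ᵇ-refl s = sumSeqs-byTopCount n s (λ i → W (suc i))
  regroup : sumTo (λ a → sumBelow (λ i → (n C i) * sumSeqs (n ∸ i) s (λ bs → W i (a ∷ bs))) (suc n)) s
            ≡ sumBelow (λ i → (n C i) * u i) (suc n)
  regroup =
    trans (sym (sumBelow-sumTo (λ i a → (n C i) * sumSeqs (n ∸ i) s (λ bs → W i (a ∷ bs))) (suc n) s))
      (sumBelow-cong (suc n) λ i i<1+n →
        trans (sym (sumTo-* (n C i) _ s))
          (cong ((n C i) *_) (trans (sym (sumSeqs-suc (n ∸ i) s (W i)))
                                    (cong (λ m → sumSeqs m s (W i)) (sym (+-∸-assoc 1 (≤-pred i<1+n)))))))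

any⇒countEq : ∀ v as → T (any (λ a → a ≡ᵇ v) as) → 1 ≤ countEq v as
any⇒countEq v (a ∷ as) t with a ≡ᵇ v
... | true  = s≤s z≤n
... | false = any⇒countEq v as t

countEq⇒any : ∀ v as → 1 ≤ countEq v as → T (any (λ a → a ≡ᵇ v) as)
countEq⇒any v (a ∷ as) t with a ≡ᵇ v
... | true  = tt
... | false = countEq⇒any v as t

removeAll-All : ∀ {P : ℕ → Set} v as → All P as → All P (removeAll v as)
removeAll-All v []       []       = []
removeAll-All v (a ∷ as) (p ∷ ps) with a ≡ᵇ v
... | true  = removeAll-All v as ps
... | false = p ∷ removeAll-All v as ps

removeAll-below : ∀ s as → All (_≤ suc s) as → All (_≤ s) (removeAll (suc s) as)
removeAll-below s []       []           = []
removeAll-below s (a ∷ as) (a≤1+s ∷ ps) with a ≡ᵇ suc s | ≡ᵇ-view a (suc s)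
... | true  | _        = removeAll-below s as ps
... | false | ne a≢1+s = ≤-pred (≤∧≢⇒< a≤1+s a≢1+s) ∷ removeAll-below s as ps

countGe-removeAll : ∀ j s as → j ≤ s → countGe (suc j) as ≡ countEq (suc s) as + countGe (suc j) (removeAll (suc s) as)
countGe-removeAll j s []       j≤s = refl
countGe-removeAll j s (a ∷ as) j≤s with a ≡ᵇ suc s | ≡ᵇ-view a (suc s)
... | true  | eq refl =
  trans (cong (_+ countGe (suc j) as) (𝟙-≤ᵇ-yes (s≤s j≤s))) (cong suc (countGe-removeAll j s as j≤s))
... | false | ne _    = begin
    𝟙 (suc j ≤ᵇ a) + countGe (suc j) as
  ≡⟨ cong (𝟙 (suc j ≤ᵇ a) +_) (countGe-removeAll j s as j≤s) ⟩
    𝟙 (suc j ≤ᵇ a) + (countEq (suc s) as + countGe (suc j) (removeAll (suc s) as))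
  ≡⟨ x+[y+z]≡y+[x+z] (𝟙 (suc j ≤ᵇ a)) (countEq (suc s) as) _ ⟩
    countEq (suc s) as + (𝟙 (suc j ≤ᵇ a) + countGe (suc j) (removeAll (suc s) as))
  ∎
  where
  open ≡-Reasoning
  x+[y+z]≡y+[x+z] : ∀ x y z → x + (y + z) ≡ y + (x + z)
  x+[y+z]≡y+[x+z] = solve-∀

countGe-bounded : ∀ j as → All (_≤ j) as → countGe (suc j) as ≡ 0
countGe-bounded j []       []         = refl
countGe-bounded j (a ∷ as) (a≤j ∷ ps) = cong₂ _+_ (𝟙-≤ᵇ-no (s≤s a≤j)) (countGe-bounded j as ps)

module RemoveTop (n s : ℕ) (as : List ℕ) (s<n : s < n) (bounded : All (_≤ suc s) as) where

  i : ℕ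
  i = countEq (suc s) as

  bs : List ℕ
  bs = removeAll (suc s) as

  bs-bounded : All (_≤ s) bs
  bs-bounded = removeAll-below s as bounded

  split : ∀ j → j ≤ s → countGe (suc j) as ≡ i + countGe (suc j) bs
  split j j≤s = countGe-removeAll j s as j≤s

  [a+x]+j≡[x+j]+a : ∀ a x j → (a + x) + j ≡ (x + j) + a
  [a+x]+j≡[x+j]+a = solve-∀

  -- Only the thresholds j ≤ s see the copies of s+1; beyond s nothing is counted.
  criterion⁻ : Criterion n as → (i ≤ n ∸ s) × Criterion (n ∸ i) bs
  criterion⁻ crit = i≤n∸s , crit-bs
    where
    i≤n∸s : i ≤ n ∸ s
    i≤n∸s = m+n≤o⇒m≤o∸n i (subst (λ x → x + s ≤ n)
                                 (trans (split s ≤-refl) (trans (cong (i +_) (countGe-bounded s bs bs-bounded))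
                                                                (+-identityʳ i)))
                                 (crit s (<⇒≤ s<n)))
    crit-bs : Criterion (n ∸ i) bs
    crit-bs j j≤n∸i with j ≤? s
    ... | yes j≤s = m+n≤o⇒m≤o∸n (countGe (suc j) bs + j)
                      (subst (_≤ n) ([a+x]+j≡[x+j]+a i (countGe (suc j) bs) j)
                             (subst (λ x → x + j ≤ n) (split j j≤s) (crit j (≤-trans j≤n∸i (m∸n≤m n i)))))
    ... | no  j≰s = subst (λ x → x + j ≤ n ∸ i)
                          (sym (countGe-bounded j bs (All.map (λ a≤s → ≤-trans a≤s (<⇒≤ (≰⇒> j≰s))) bs-bounded)))
                          j≤n∸i

  criterion⁺ : i ≤ n ∸ s → Criterion (n ∸ i) bs → Criterion n as
  criterion⁺ i≤n∸s crit-bs j j≤n with j ≤? s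
  ... | yes j≤s = subst (λ y → y + j ≤ n) (sym (split j j≤s))
                        (subst (_≤ n) (sym ([a+x]+j≡[x+j]+a i (countGe (suc j) bs) j)) fits)
    where
    j≤n∸i : j ≤ n ∸ i
    j≤n∸i = m+n≤o⇒m≤o∸n j (≤-trans (+-mono-≤ j≤s i≤n∸s) (≤-reflexive (m+[n∸m]≡n (<⇒≤ s<n))))
    fits : countGe (suc j) bs + j + i ≤ n
    fits = m≤o∸n⇒m+n≤o (countGe (suc j) bs + j) (≤-trans i≤n∸s (m∸n≤m n s)) (crit-bs j j≤n∸i)
  ... | no  j≰s = subst (λ x → x + j ≤ n)
                        (sym (countGe-bounded j as (All.map (λ a≤1+s → ≤-trans a≤1+s (≰⇒> j≰s)) bounded)))
                        j≤n

parking-removeTop : ∀ n s as → s < n → All (λ a → (1 ≤ a) × (a ≤ suc s)) as →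
  (isParkingFunction n as ∧ any (λ a → a ≡ᵇ suc s) as)
    ≡ (((1 ≤ᵇ countEq (suc s) as) ∧ (countEq (suc s) as ≤ᵇ n ∸ s))
       ∧ isParkingFunction (n ∸ countEq (suc s) as) (removeAll (suc s) as))
parking-removeTop n s as s<n range = T-ext to from
  where
  open RemoveTop n s as s<n (All.map proj₂ range)
  1≤as : All (1 ≤_) as
  1≤as = All.map proj₁ range
  1≤bs : All (1 ≤_) bs
  1≤bs = removeAll-All (suc s) as 1≤as
  to : T (isParkingFunction n as ∧ any (λ a → a ≡ᵇ suc s) as) →
       T (((1 ≤ᵇ i) ∧ (i ≤ᵇ n ∸ s)) ∧ isParkingFunction (n ∸ i) bs)
  to t with T-∧⁻ t
  ... | pf , uses-top with criterion⁻ (proj₁ (parking-criterion n as 1≤as) pf)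
  ...   | i≤n∸s , crit-bs =
    T-∧⁺ (T-∧⁺ (≤⇒≤ᵇ (any⇒countEq (suc s) as uses-top) , ≤⇒≤ᵇ i≤n∸s) ,
          proj₂ (parking-criterion (n ∸ i) bs 1≤bs) crit-bs)
  from : T (((1 ≤ᵇ i) ∧ (i ≤ᵇ n ∸ s)) ∧ isParkingFunction (n ∸ i) bs) →
         T (isParkingFunction n as ∧ any (λ a → a ≡ᵇ suc s) as)
  from t with T-∧⁻ t
  ... | bounds , pf-bs with T-∧⁻ bounds
  ...   | 1≤i , i≤n∸s =
    T-∧⁺ (proj₂ (parking-criterion n as 1≤as)
                (criterion⁺ (≤ᵇ⇒≤ i (n ∸ s) i≤n∸s) (proj₁ (parking-criterion (n ∸ i) bs 1≤bs) pf-bs)) ,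
          countEq⇒any (suc s) as (≤ᵇ⇒≤ 1 i 1≤i))

pfBounded : ℕ → ℕ → ℕ
pfBounded m t = sumSeqs m t (λ bs → 𝟙 (isParkingFunction m bs))

pfWithMax : ℕ → ℕ → ℕ
pfWithMax m t = sumSeqs m t (λ as → 𝟙 (isParkingFunction m as ∧ any (λ a → a ≡ᵇ t) as))

pEq≡pfWithMax : ∀ m t → t ≤ m → pEq m t ≡ pfWithMax m t
pEq≡pfWithMax m t t≤m =
  trans (length-filter _ (seqs m m))
    (trans (sumSeqs-cong m m λ as _ → 𝟙-pick (isParkingFunction m as) (all (λ a → a ≤ᵇ t) as) _)
           (sumSeqs-restrict m m t _ t≤m))
  where
  𝟙-pick : ∀ x y z → 𝟙 (x ∧ (y ∧ z)) ≡ 𝟙 y * 𝟙 (x ∧ z)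
  𝟙-pick true  true  z = sym (+-identityʳ _)
  𝟙-pick true  false z = refl
  𝟙-pick false true  z = sym (+-identityʳ _)
  𝟙-pick false false z = refl

pfBounded-suc : ∀ m t → pfBounded m (suc t) ≡ pfWithMax m (suc t) + pfBounded m t
pfBounded-suc m t =
  trans (sumSeqs-cong m (suc t) λ as (_ , range) →
           trans (𝟙-split (isParkingFunction m as) (all (λ a → a ≤ᵇ t) as))
                 (cong (λ b → 𝟙 (isParkingFunction m as ∧ b) + 𝟙 (all (λ a → a ≤ᵇ t) as) * 𝟙 (isParkingFunction m as))
                       (sym (uses-top as (All.map proj₂ range)))))
    (trans (sym (sumOver-+ (seqs m (suc t)) _ _))
           (cong (pfWithMax m (suc t) +_) (sumSeqs-restrict m (suc t) t _ (n≤1+n t))))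
  where
  𝟙-split : ∀ x z → 𝟙 x ≡ 𝟙 (x ∧ not z) + 𝟙 z * 𝟙 x
  𝟙-split true  true  = refl
  𝟙-split true  false = refl
  𝟙-split false true  = refl
  𝟙-split false false = refl
  uses-top : ∀ as → All (_≤ suc t) as → any (λ a → a ≡ᵇ suc t) as ≡ not (all (λ a → a ≤ᵇ t) as)
  uses-top []       []           = refl
  uses-top (a ∷ as) (a≤1+t ∷ ps) with a ≡ᵇ suc t | ≡ᵇ-view a (suc t)
  ... | true  | eq refl with t <ᵇ t | <ᵇ-view t t
  ...   | true  | lt t<t = ⊥-elim (<-irrefl refl t<t)
  ...   | false | _      = refl
  uses-top (a ∷ as) (a≤1+t ∷ ps) | false | ne a≢1+t with a ≤ᵇ t | ≤ᵇ-view a t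
  ... | true  | le _   = uses-top as ps
  ... | false | gt t<a = ⊥-elim (a≢1+t (≤-antisym a≤1+t t<a))

-- The recursion behind Corollary 2.9: a parking function of length n with
-- maximum s+1 consists of j+1 ≤ n ∸ s copies of s+1, placed in C(n, j+1)
-- ways, and a parking function of length n ∸ (j+1) with entries ≤ s.
pEq-suc : ∀ n s → s < n →
          pEq n (suc s) ≡ sumBelow (λ j → (n C suc j) * pfBounded (n ∸ suc j) s) (n ∸ s)
pEq-suc n s s<n = begin
    pEq n (suc s)
  ≡⟨ pEq≡pfWithMax n (suc s) s<n ⟩
    pfWithMax n (suc s)
  ≡⟨ sumSeqs-cong n (suc s) (λ as (_ , range) → cong 𝟙 (parking-removeTop n s as s<n range)) ⟩
    sumSeqs n (suc s) (λ as → W (countEq (suc s) as) (removeAll (suc s) as))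
  ≡⟨ sumSeqs-byTopCount n s W ⟩
    sumBelow (λ i → (n C i) * sumSeqs (n ∸ i) s (W i)) (suc n)
  ≡⟨ sumBelow-cong (suc n) (λ i _ → cong ((n C i) *_) (factor i)) ⟩
    sumBelow (λ i → (n C i) * (𝟙 (allowed i) * pfBounded (n ∸ i) s)) (suc n)
  ≡⟨ cong (_+ sumBelow (λ j → (n C suc j) * (𝟙 (allowed (suc j)) * pfBounded (n ∸ suc j) s)) n) (*-zeroʳ (n C 0)) ⟩
    sumBelow (λ j → (n C suc j) * (𝟙 (allowed (suc j)) * pfBounded (n ∸ suc j) s)) n
  ≡⟨ sumBelow-cong n (λ j _ → x*[y*z]≡y*[x*z] (n C suc j) (𝟙 (suc j ≤ᵇ n ∸ s)) _) ⟩
    sumBelow (λ j → 𝟙 (suc j ≤ᵇ n ∸ s) * ((n C suc j) * pfBounded (n ∸ suc j) s)) n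
  ≡⟨ sumBelow-restrict (n ∸ s) n _ (m∸n≤m n s) ⟩
    sumBelow (λ j → (n C suc j) * pfBounded (n ∸ suc j) s) (n ∸ s)
  ∎
  where
  open ≡-Reasoning
  allowed : ℕ → Bool
  allowed i = (1 ≤ᵇ i) ∧ (i ≤ᵇ n ∸ s)
  W : ℕ → List ℕ → ℕ
  W i bs = 𝟙 (allowed i ∧ isParkingFunction (n ∸ i) bs)
  factor : ∀ i → sumSeqs (n ∸ i) s (W i) ≡ 𝟙 (allowed i) * pfBounded (n ∸ i) s
  factor i = trans (sumSeqs-cong (n ∸ i) s λ bs _ → 𝟙-∧ (allowed i) (isParkingFunction (n ∸ i) bs))
                   (sym (sumOver-* (seqs (n ∸ i) s) (𝟙 (allowed i)) _))
  x*[y*z]≡y*[x*z] : ∀ x y z → x * (y * z) ≡ y * (x * z)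
  x*[y*z]≡y*[x*z] = solve-∀

countLe : ℕ → List ℕ → ℕ
countLe j []       = 0
countLe j (x ∷ xs) = 𝟙 (x ≤ᵇ j) + countLe j xs

countGe+countLe : ∀ j xs → countGe (suc j) xs + countLe j xs ≡ length xs
countGe+countLe j []       = refl
countGe+countLe j (x ∷ xs) =
  trans (+-interchange (𝟙 (j <ᵇ x)) (countGe (suc j) xs) (𝟙 (x ≤ᵇ j)) (countLe j xs))
        (cong₂ _+_ (one-side x) (countGe+countLe j xs))
  where
  one-side : ∀ x → 𝟙 (j <ᵇ x) + 𝟙 (x ≤ᵇ j) ≡ 1
  one-side x with x ≤ᵇ j | ≤ᵇ-view x j
  ... | true  | le x≤j = cong (_+ 1) (𝟙-<ᵇ-no x≤j)
  ... | false | gt j<x = cong (_+ 0) (𝟙-<ᵇ-yes j<x)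

countLe-zero : ∀ xs → All (1 ≤_) xs → countLe 0 xs ≡ 0
countLe-zero []       []         = refl
countLe-zero (x ∷ xs) (1≤x ∷ ps) = cong₂ _+_ (𝟙-≤ᵇ-no 1≤x) (countLe-zero xs ps)

countLe-all : ∀ N xs → All (_≤ N) xs → countLe N xs ≡ length xs
countLe-all N []       []         = refl
countLe-all N (x ∷ xs) (x≤N ∷ ps) = cong₂ _+_ (𝟙-≤ᵇ-yes x≤N) (countLe-all N xs ps)

CriterionLe : ℕ → List ℕ → Set
CriterionLe m b = ∀ j → j ≤ m → j ≤ countLe j b

criterion⇒criterionLe : ∀ m b → length b ≡ m → Criterion m b → CriterionLe m b
criterion⇒criterionLe m b len crit j j≤m =
  +-cancelˡ-≤ (countGe (suc j) b) _ _
    (subst (countGe (suc j) b + j ≤_) (sym (trans (countGe+countLe j b) len)) (crit j j≤m))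

criterionLe⇒criterion : ∀ m b → length b ≡ m → CriterionLe m b → Criterion m b
criterionLe⇒criterion m b len crit j j≤m =
  subst (countGe (suc j) b + j ≤_) (trans (countGe+countLe j b) len) (+-monoʳ-≤ (countGe (suc j) b) (crit j j≤m))

-- The cyclic shift of [1, d + r] sending r ↦ d + r and r + 1 ↦ 1.
rotate : ℕ → ℕ → ℕ → ℕ
rotate d r x = if x ≤ᵇ r then x + d else x ∸ r

rotate-pos : ∀ d r x → 1 ≤ x → 1 ≤ rotate d r x
rotate-pos d r x 1≤x with x ≤ᵇ r | ≤ᵇ-view x r
... | true  | _      = ≤-trans 1≤x (m≤m+n x d)
... | false | gt r<x = m<n⇒0<n∸m r<x

rotate-low : ∀ d r j x → 1 ≤ x → j ≤ d → 𝟙 (rotate d r x ≤ᵇ j) + 𝟙 (x ≤ᵇ r) ≡ 𝟙 (x ≤ᵇ j + r)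
rotate-low d r j x 1≤x j≤d with x ≤ᵇ r | ≤ᵇ-view x r
... | true  | le x≤r =
  trans (cong (_+ 1) (𝟙-≤ᵇ-no (≤-<-trans j≤d (m<n+m d 1≤x)))) (sym (𝟙-≤ᵇ-yes (≤-trans x≤r (m≤n+m r j))))
... | false | gt r<x =
  trans (+-identityʳ _)
        (𝟙-≤ᵇ-cong (λ x∸r≤j → subst (_≤ j + r) (m∸n+n≡m (<⇒≤ r<x)) (+-monoˡ-≤ r x∸r≤j))
                   (λ x≤j+r → m≤n+o⇒m∸n≤o x r (subst (x ≤_) (+-comm j r) x≤j+r)))

rotate-high : ∀ d r i x → 1 ≤ x → x ≤ d + r → i < r →
              𝟙 (rotate d r x ≤ᵇ d + i) + 𝟙 (x ≤ᵇ r) ≡ 𝟙 (x ≤ᵇ i) + 1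
rotate-high d r i x 1≤x x≤d+r i<r with x ≤ᵇ r | ≤ᵇ-view x r
... | true  | le x≤r =
  cong (_+ 1) (𝟙-≤ᵇ-cong (λ x+d≤d+i → +-cancelˡ-≤ d x i (subst (_≤ d + i) (+-comm x d) x+d≤d+i))
                         (λ x≤i → subst (_≤ d + i) (+-comm d x) (+-monoʳ-≤ d x≤i)))
... | false | gt r<x =
  trans (cong (_+ 0) (𝟙-≤ᵇ-yes (≤-trans (m≤n+o⇒m∸n≤o x r (subst (x ≤_) (+-comm d r) x≤d+r)) (m≤m+n d i))))
        (sym (cong (_+ 1) (𝟙-≤ᵇ-no (<-trans i<r r<x))))

countLe-rotate-low : ∀ d r j xs → j ≤ d → All (1 ≤_) xs →
                     countLe j (map (rotate d r) xs) + countLe r xs ≡ countLe (j + r) xs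
countLe-rotate-low d r j []       j≤d []         = refl
countLe-rotate-low d r j (x ∷ xs) j≤d (1≤x ∷ ps) =
  trans (+-interchange (𝟙 (rotate d r x ≤ᵇ j)) (countLe j (map (rotate d r) xs)) (𝟙 (x ≤ᵇ r)) (countLe r xs))
        (cong₂ _+_ (rotate-low d r j x 1≤x j≤d) (countLe-rotate-low d r j xs j≤d ps))

countLe-rotate-high : ∀ d r i xs → i < r → All (λ x → (1 ≤ x) × (x ≤ d + r)) xs →
                      countLe (d + i) (map (rotate d r) xs) + countLe r xs ≡ countLe i xs + length xs
countLe-rotate-high d r i []       i<r []                 = refl
countLe-rotate-high d r i (x ∷ xs) i<r ((1≤x , x≤d+r) ∷ ps) =
  trans (+-interchange (𝟙 (rotate d r x ≤ᵇ d + i)) (countLe (d + i) (map (rotate d r) xs)) (𝟙 (x ≤ᵇ r)) (countLe r xs))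
    (trans (cong₂ _+_ (rotate-high d r i x 1≤x x≤d+r i<r) (countLe-rotate-high d r i xs i<r ps))
           ([a+1]+[b+c]≡[a+b]+[1+c] (𝟙 (x ≤ᵇ i)) (countLe i xs) (length xs)))
  where
  [a+1]+[b+c]≡[a+b]+[1+c] : ∀ a b c → (a + 1) + (b + c) ≡ (a + b) + suc c
  [a+1]+[b+c]≡[a+b]+[1+c] = solve-∀

LeftmostMin : ℕ → (ℕ → ℕ) → ℕ → Set
LeftmostMin K g r = (∀ i → i < r → g r < g i) × (∀ i → r < i → i ≤ K → g r ≤ g i)

≤-suc-cases : ∀ {i K} → i ≤ suc K → (i ≤ K) ⊎ (i ≡ suc K)
≤-suc-cases {zero}              _         = inj₁ z≤n
≤-suc-cases {suc i} {zero}      (s≤s z≤n) = inj₂ refl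
≤-suc-cases {suc i} {suc K}     (s≤s i≤K) with ≤-suc-cases i≤K
... | inj₁ i≤K' = inj₁ (s≤s i≤K')
... | inj₂ i≡K  = inj₂ (cong suc i≡K)

leftmostMin : ∀ (g : ℕ → ℕ) K →
  Σ ℕ λ r → (r ≤ K) × (∀ i → i ≤ K → g r ≤ g i) × LeftmostMin K g r × (∀ r' → r' ≤ K → LeftmostMin K g r' → r' ≡ r)
leftmostMin g zero =
  0 , z≤n , (λ i i≤0 → ≤-reflexive (cong g (sym (n≤0⇒n≡0 i≤0)))) ,
  ((λ i ()) , (λ i 0<i i≤0 → ⊥-elim (<⇒≱ 0<i i≤0))) , (λ r' r'≤0 _ → n≤0⇒n≡0 r'≤0)
leftmostMin g (suc K) with leftmostMin g K
... | r , r≤K , minimal , (left , right) , unique with g r ≤? g (suc K)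
...   | yes gr≤gK = r , m≤n⇒m≤1+n r≤K , minimal' , (left , right') , unique'
  where
  minimal' : ∀ i → i ≤ suc K → g r ≤ g i
  minimal' i i≤1+K with ≤-suc-cases i≤1+K
  ... | inj₁ i≤K  = minimal i i≤K
  ... | inj₂ refl = gr≤gK
  right' : ∀ i → r < i → i ≤ suc K → g r ≤ g i
  right' i r<i i≤1+K with ≤-suc-cases i≤1+K
  ... | inj₁ i≤K  = right i r<i i≤K
  ... | inj₂ refl = gr≤gK
  unique' : ∀ r' → r' ≤ suc K → LeftmostMin (suc K) g r' → r' ≡ r
  unique' r' r'≤1+K (left' , right'') with ≤-suc-cases r'≤1+K
  ... | inj₁ r'≤K  = unique r' r'≤K (left' , λ i r'<i i≤K → right'' i r'<i (m≤n⇒m≤1+n i≤K))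
  ... | inj₂ refl = ⊥-elim (<⇒≱ (left' r (s≤s r≤K)) gr≤gK)
...   | no  gr≰gK = suc K , ≤-refl , minimal' , (left' , λ i K<i i≤K → ⊥-elim (<⇒≱ K<i i≤K)) , unique'
  where
  gK<gr : g (suc K) < g r
  gK<gr = ≰⇒> gr≰gK
  minimal' : ∀ i → i ≤ suc K → g (suc K) ≤ g i
  minimal' i i≤1+K with ≤-suc-cases i≤1+K
  ... | inj₁ i≤K  = <⇒≤ (<-≤-trans gK<gr (minimal i i≤K))
  ... | inj₂ refl = ≤-refl
  left' : ∀ i → i < suc K → g (suc K) < g i
  left' i i<1+K = <-≤-trans gK<gr (minimal i (≤-pred i<1+K))
  unique' : ∀ r' → r' ≤ suc K → LeftmostMin (suc K) g r' → r' ≡ suc K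
  unique' r' r'≤1+K (_ , right'') with ≤-suc-cases r'≤1+K
  ... | inj₁ r'≤K = ⊥-elim (<⇒≱ gK<gr (≤-trans (minimal r' r'≤K) (right'' (suc K) (s≤s r'≤K) ≤-refl)))
  ... | inj₂ r'≡1+K = r'≡1+K

∸-exchange-≤ : ∀ N a c r i → r ≤ N → i ≤ N →
               (a + (N ∸ r) ≤ c + (N ∸ i) → a + i ≤ c + r) × (a + i ≤ c + r → a + (N ∸ r) ≤ c + (N ∸ i))
∸-exchange-≤ N a c r i r≤N i≤N =
  (λ le → +-cancelʳ-≤ N _ _ (subst₂ _≤_ lhs rhs (+-monoˡ-≤ (r + i) le))) ,
  (λ le → +-cancelʳ-≤ (r + i) _ _ (subst₂ _≤_ (sym lhs) (sym rhs) (+-monoˡ-≤ N le)))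
  where
  lhs : (a + (N ∸ r)) + (r + i) ≡ (a + i) + N
  lhs = trans (reorder a (N ∸ r) r i) (cong ((a + i) +_) (m∸n+n≡m r≤N))
    where reorder : ∀ a e r i → (a + e) + (r + i) ≡ (a + i) + (e + r)
          reorder = solve-∀
  rhs : (c + (N ∸ i)) + (r + i) ≡ (c + r) + N
  rhs = trans (reorder c (N ∸ i) r i) (cong ((c + r) +_) (m∸n+n≡m i≤N))
    where reorder : ∀ c e r i → (c + e) + (r + i) ≡ (c + r) + (e + i)
          reorder = solve-∀

-- For xs ∈ [1, m+1]^m consider the "height"
--   g i = #{x ≤ i} + (m + 1 ∸ i),   0 ≤ i ≤ m + 1.
-- The rotation of xs that sends r to m + 1 satisfies the criterion exactly
-- when r is the leftmost minimum of g.
module Rotation (xs : List ℕ) (m : ℕ) (len : length xs ≡ m)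
                (range : All (λ x → (1 ≤ x) × (x ≤ suc m)) xs) where

  N : ℕ
  N = suc m

  L : ℕ → ℕ
  L j = countLe j xs

  g : ℕ → ℕ
  g i = L i + (N ∸ i)

  1≤xs : All (1 ≤_) xs
  1≤xs = All.map proj₁ range

  module Shift (d r : ℕ) (1≤r : 1 ≤ r) (d+r≡N : d + r ≡ N) where

    b : List ℕ
    b = map (rotate d r) xs

    range' : All (λ x → (1 ≤ x) × (x ≤ d + r)) xs
    range' = All.map (λ {x} (1≤x , x≤N) → 1≤x , subst (x ≤_) (sym d+r≡N) x≤N) range

    r≤N : r ≤ N
    r≤N = subst (r ≤_) d+r≡N (m≤n+m r d)

    d≤m : d ≤ m
    d≤m = ≤-pred (subst (suc d ≤_) d+r≡N (subst (_≤ d + r) (+-comm d 1) (+-monoʳ-≤ d 1≤r)))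

    low : ∀ j → j ≤ d → countLe j b + L r ≡ L (j + r)
    low j j≤d = countLe-rotate-low d r j xs j≤d 1≤xs

    high : ∀ i → i < r → countLe (d + i) b + L r ≡ L i + m
    high i i<r = trans (countLe-rotate-high d r i xs i<r range') (cong (L i +_) len)

    suc-[d+i+a]≡suc-[a+i]+d : ∀ a i d → suc (d + i + a) ≡ suc (a + i) + d
    suc-[d+i+a]≡suc-[a+i]+d = solve-∀

    suc-[c+m]≡[c+r]+d : ∀ c → suc (c + m) ≡ (c + r) + d
    suc-[c+m]≡[c+r]+d c = trans (sym (+-suc c m)) (trans (cong (c +_) (sym d+r≡N)) (shuffle c r d))
      where shuffle : ∀ c r d → c + (d + r) ≡ (c + r) + d
            shuffle = solve-∀

    [j+a]+r≡a+[j+r] : ∀ j a r → (j + a) + r ≡ a + (j + r)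
    [j+a]+r≡a+[j+r] = solve-∀

    parks⇒leftmostMin : CriterionLe m b → LeftmostMin N g r
    parks⇒leftmostMin crit = before , after
      where
      before : ∀ i → i < r → g r < g i
      before i i<r =
        proj₂ (∸-exchange-≤ N (suc (L r)) (L i) r i r≤N (≤-trans (<⇒≤ i<r) r≤N))
              (+-cancelʳ-≤ d _ _ (subst₂ _≤_ (suc-[d+i+a]≡suc-[a+i]+d (L r) i d) (suc-[c+m]≡[c+r]+d (L i)) (s≤s fits)))
        where
        d+i≤m : d + i ≤ m
        d+i≤m = ≤-pred (subst (d + i <_) d+r≡N (+-monoʳ-< d i<r))
        fits : d + i + L r ≤ L i + m
        fits = subst (d + i + L r ≤_) (high i i<r) (+-monoˡ-≤ (L r) (crit (d + i) d+i≤m))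
      after : ∀ i → r < i → i ≤ N → g r ≤ g i
      after i r<i i≤N = proj₂ (∸-exchange-≤ N (L r) (L i) r i r≤N i≤N) (subst (λ z → L r + z ≤ L z + r) j+r≡i fits)
        where
        j : ℕ
        j = i ∸ r
        j+r≡i : j + r ≡ i
        j+r≡i = m∸n+n≡m (<⇒≤ r<i)
        j≤d : j ≤ d
        j≤d = +-cancelʳ-≤ r j d (subst₂ _≤_ (sym j+r≡i) (sym d+r≡N) i≤N)
        fits : L r + (j + r) ≤ L (j + r) + r
        fits = subst₂ _≤_ ([j+a]+r≡a+[j+r] j (L r) r) refl
                 (+-monoˡ-≤ r (subst (j + L r ≤_) (low j j≤d) (+-monoˡ-≤ (L r) (crit j (≤-trans j≤d d≤m)))))

    leftmostMin⇒parks : LeftmostMin N g r → CriterionLe m b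
    leftmostMin⇒parks (before , after) j j≤m with j ≤? d
    ... | yes j≤d = within j j≤d
      where
      within : ∀ j → j ≤ d → j ≤ countLe j b
      within zero    _   = z≤n
      within (suc j) j<d =
        +-cancelʳ-≤ (L r) _ _
          (subst (suc j + L r ≤_) (sym (low (suc j) j<d))
                 (+-cancelʳ-≤ r _ _ (subst (_≤ L (suc j + r) + r) (sym ([j+a]+r≡a+[j+r] (suc j) (L r) r)) fits)))
        where
        j+r≤N : suc j + r ≤ N
        j+r≤N = subst (suc j + r ≤_) d+r≡N (+-monoˡ-≤ r j<d)
        fits : L r + (suc j + r) ≤ L (suc j + r) + r
        fits = proj₁ (∸-exchange-≤ N (L r) (L (suc j + r)) r (suc j + r) r≤N j+r≤N)
                     (after (suc j + r) (m<n+m r (s≤s z≤n)) j+r≤N)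
    ... | no  j≰d =
      subst (λ z → z ≤ countLe z b) d+i≡j (+-cancelʳ-≤ (L r) _ _ (subst (d + i + L r ≤_) (sym (high i i<r)) fits))
      where
      i : ℕ
      i = j ∸ d
      d+i≡j : d + i ≡ j
      d+i≡j = m+[n∸m]≡n (<⇒≤ (≰⇒> j≰d))
      i<r : i < r
      i<r = +-cancelˡ-< d i r (subst₂ _<_ (sym d+i≡j) (sym d+r≡N) (s≤s j≤m))
      fits : d + i + L r ≤ L i + m
      fits = ≤-pred (subst₂ _≤_ (sym (suc-[d+i+a]≡suc-[a+i]+d (L r) i d)) (sym (suc-[c+m]≡[c+r]+d (L i)))
                      (+-monoˡ-≤ d (proj₁ (∸-exchange-≤ N (suc (L r)) (L i) r i r≤N (≤-trans (<⇒≤ i<r) r≤N))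
                                               (before i i<r))))

-- The shift is a bijection of [1, r + d], so sums over it are invariant.
sumTo-rotate : ∀ d r h → sumTo (λ v → h (rotate d r v)) (r + d) ≡ sumTo h (r + d)
sumTo-rotate d r h = begin
    sumTo (λ v → h (rotate d r v)) (r + d)
  ≡⟨ sumTo-split (λ v → h (rotate d r v)) r d ⟩
    sumTo (λ v → h (rotate d r v)) r + sumTo (λ u → h (rotate d r (r + u))) d
  ≡⟨ cong₂ _+_ (sumTo-cong r λ q _ q≤r → cong h (lower q q≤r)) (sumTo-cong d λ u 1≤u _ → cong h (upper u 1≤u)) ⟩
    sumTo (λ v → h (v + d)) r + sumTo h d
  ≡⟨ +-comm _ (sumTo h d) ⟩
    sumTo h d + sumTo (λ v → h (v + d)) r
  ≡⟨ cong (sumTo h d +_) (sumTo-cong r λ v _ _ → cong h (+-comm v d)) ⟩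
    sumTo h d + sumTo (λ u → h (d + u)) r
  ≡⟨ sym (sumTo-split h d r) ⟩
    sumTo h (d + r)
  ≡⟨ cong (sumTo h) (+-comm d r) ⟩
    sumTo h (r + d)
  ∎
  where
  open ≡-Reasoning
  lower : ∀ q → q ≤ r → rotate d r q ≡ q + d
  lower q q≤r with q ≤ᵇ r | ≤ᵇ-view q r
  ... | true  | _      = refl
  ... | false | gt r<q = ⊥-elim (<⇒≱ r<q q≤r)
  upper : ∀ u → 1 ≤ u → rotate d r (r + u) ≡ u
  upper u 1≤u with r + u ≤ᵇ r | ≤ᵇ-view (r + u) r
  ... | true  | le r+u≤r = ⊥-elim (<⇒≱ (subst (_≤ r + u) (+-comm r 1) (+-monoʳ-≤ r 1≤u)) r+u≤r)
  ... | false | _        = m+n∸m≡n r u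

-- Rotating every entry permutes [1, N]^m, so sums over it are invariant.
sumSeqs-rotate : ∀ m N d r (w : List ℕ → ℕ) → r + d ≡ N →
                 sumSeqs m N (λ as → w (map (rotate d r) as)) ≡ sumSeqs m N w
sumSeqs-rotate zero    N d r w r+d≡N = refl
sumSeqs-rotate (suc m) N d r w r+d≡N =
  trans (sumSeqs-suc m N _)
    (trans (sumTo-cong N λ x _ _ → sumSeqs-rotate m N d r (λ as → w (rotate d r x ∷ as)) r+d≡N)
      (trans (subst (λ K → sumTo (λ x → head (rotate d r x)) K ≡ sumTo head K) r+d≡N (sumTo-rotate d r head))
             (sym (sumSeqs-suc m N w))))
  where
  head : ℕ → ℕ
  head u = sumSeqs m N (λ as → w (u ∷ as))

exactly-one-rotation-parks : ∀ xs m → length xs ≡ m → All (λ x → (1 ≤ x) × (x ≤ suc m)) xs →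
  sumTo (λ r → 𝟙 (isParkingFunction m (map (rotate (suc m ∸ r) r) xs))) (suc m) ≡ 1
exactly-one-rotation-parks xs m len range =
  trans (sumTo-cong N parks-iff-leftmost) (sumTo-delta (λ _ → true) r₀ N 1≤r₀ r₀≤N)
  where
  open Rotation xs m len range
  r₀ : ℕ
  r₀ = proj₁ (leftmostMin g N)
  r₀≤N : r₀ ≤ N
  r₀≤N = proj₁ (proj₂ (leftmostMin g N))
  r₀-leftmost : LeftmostMin N g r₀
  r₀-leftmost = proj₁ (proj₂ (proj₂ (proj₂ (leftmostMin g N))))
  r₀-unique : ∀ r → r ≤ N → LeftmostMin N g r → r ≡ r₀
  r₀-unique = proj₂ (proj₂ (proj₂ (proj₂ (leftmostMin g N))))
  -- g 0 = m + 1 exceeds g (m + 1) = m, so the leftmost minimum is not at 0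
  1≤r₀ : 1 ≤ r₀
  1≤r₀ with r₀ | r₀-leftmost
  ... | suc _ | _           = s≤s z≤n
  ... | zero  | (_ , after) =
    ⊥-elim (<-irrefl refl
      (subst₂ _≤_ (cong (_+ N) (countLe-zero xs 1≤xs))
                  (trans (cong (_+ (N ∸ N)) (trans (countLe-all N xs (All.map proj₂ range)) len))
                         (trans (cong (m +_) (n∸n≡0 N)) (+-identityʳ m)))
                  (after N (s≤s z≤n) ≤-refl)))
  parks-iff-leftmost : ∀ r → 1 ≤ r → r ≤ N →
    𝟙 (isParkingFunction m (map (rotate (N ∸ r) r) xs)) ≡ 𝟙 ((r ≡ᵇ r₀) ∧ true)
  parks-iff-leftmost r 1≤r r≤N = cong 𝟙 (T-ext to from)
    where
    open Shift (N ∸ r) r 1≤r (m∸n+n≡m r≤N) using (b; parks⇒leftmostMin; leftmostMin⇒parks)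
    1≤b : All (1 ≤_) b
    1≤b = All-map⁺ (All.map (λ {x} → rotate-pos (N ∸ r) r x) (All.map proj₁ range))
    len-b : length b ≡ m
    len-b = trans (length-map (rotate (N ∸ r) r) xs) len
    to : T (isParkingFunction m b) → T ((r ≡ᵇ r₀) ∧ true)
    to pf = T-∧⁺ (≡⇒≡ᵇ r r₀ (r₀-unique r r≤N (parks⇒leftmostMin
                   (criterion⇒criterionLe m b len-b (proj₁ (parking-criterion m b 1≤b) pf)))) , tt)
    from : T ((r ≡ᵇ r₀) ∧ true) → T (isParkingFunction m b)
    from t = proj₂ (parking-criterion m b 1≤b)
               (criterionLe⇒criterion m b len-b
                 (leftmostMin⇒parks (subst (LeftmostMin N g) (sym (≡ᵇ⇒≡ r r₀ (proj₁ (T-∧⁻ t)))) r₀-leftmost)))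

countGe-zero⇒all : ∀ j as → countGe (suc j) as ≡ 0 → all (λ a → a ≤ᵇ j) as ≡ true
countGe-zero⇒all j []       _    = refl
countGe-zero⇒all j (a ∷ as) none with a ≤ᵇ j | ≤ᵇ-view a j
... | true  | le a≤j = countGe-zero⇒all j as (trans (sym (cong (_+ countGe (suc j) as) (𝟙-<ᵇ-no a≤j))) none)
... | false | gt j<a = ⊥-elim (0≢1+n (sym (trans (sym (cong (_+ countGe (suc j) as) (𝟙-<ᵇ-yes j<a))) none)))

-- A parking function of length m has no entry m + 1, so allowing it changes nothing.
pfBounded-self : ∀ m → pfBounded m m ≡ sumSeqs m (suc m) (λ as → 𝟙 (isParkingFunction m as))
pfBounded-self m = sym (trans (sumSeqs-cong m (suc m) bounded) (sumSeqs-restrict m (suc m) m _ (n≤1+n m)))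
  where
  bounded : ∀ as → InSeqs m (suc m) as →
            𝟙 (isParkingFunction m as) ≡ 𝟙 (all (λ a → a ≤ᵇ m) as) * 𝟙 (isParkingFunction m as)
  bounded as (_ , range) with isParkingFunction m as in pf
  ... | false = sym (*-zeroʳ (𝟙 (all (λ a → a ≤ᵇ m) as)))
  ... | true  = sym (cong (λ z → 𝟙 z * 1) (countGe-zero⇒all m as (n≤0⇒n≡0 (+-cancelʳ-≤ m _ 0 crit))))
    where
    crit : countGe (suc m) as + m ≤ m
    crit = proj₁ (parking-criterion m as (All.map proj₁ range)) (subst T (sym pf) tt) m ≤-refl

-- Summing over all m + 1 rotations of [1, m+1]^m counts each
-- parking function m + 1 times and, by the cycle lemma, each orbit once.
cayley : ∀ m → pfBounded m m ≡ suc m ^ (m ∸ 1)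
cayley zero      = refl
cayley (suc m-1) = *-cancelˡ-≡ _ _ N (begin
    N * pfBounded m m
  ≡⟨ cong (N *_) (pfBounded-self m) ⟩
    N * sumSeqs m N isPF
  ≡⟨ sym (sumTo-const _ N) ⟩
    sumTo (λ r → sumSeqs m N isPF) N
  ≡⟨ sym (sumTo-cong N λ r _ r≤N → sumSeqs-rotate m N (N ∸ r) r isPF (m+[n∸m]≡n r≤N)) ⟩
    sumTo (λ r → sumSeqs m N (λ as → isPF (map (rotate (N ∸ r) r) as))) N
  ≡⟨ sym (sumOver-sumTo (seqs m N) (λ r as → isPF (map (rotate (N ∸ r) r) as)) N) ⟩
    sumSeqs m N (λ as → sumTo (λ r → isPF (map (rotate (N ∸ r) r) as)) N)
  ≡⟨ sumSeqs-cong m N (λ as (len , range) → exactly-one-rotation-parks as m len range) ⟩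
    sumSeqs m N (λ _ → 1)
  ≡⟨ sumSeqs-one m N ⟩
    N * N ^ m-1
  ∎)
  where
  open ≡-Reasoning
  m N : ℕ
  m = suc m-1
  N = suc m
  isPF : List ℕ → ℕ
  isPF as = 𝟙 (isParkingFunction m as)

sum-upTo : ∀ f k → sum (map f (upTo k)) ≡ sumBelow f k
sum-upTo f k = go f (λ j → j) k
  where
  go : ∀ f h k → sum (map f (applyUpTo h k)) ≡ sumBelow (λ j → f (h j)) k
  go f h zero    = refl
  go f h (suc k) = cong (f (h 0) +_) (go f (λ j → h (suc j)) k)

-- A parking function of length n with maximum n has exactly one entry n, in
-- one of n positions, next to a parking function of length n - 1; by
-- Cayley's formula  p_{n;=n} = n · n^(n-2) = n^(n-1).
pEq-diagonal : ∀ n → 1 ≤ n → pEq n n ≡ n ^ (n ∸ 1)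
pEq-diagonal (suc m) _ = begin
    pEq (suc m) (suc m)
  ≡⟨ pEq-suc (suc m) m ≤-refl ⟩
    sumBelow (λ j → (suc m C suc j) * pfBounded (m ∸ j) m) (suc m ∸ m)
  ≡⟨ cong (sumBelow (λ j → (suc m C suc j) * pfBounded (m ∸ j) m)) (m+n∸n≡m 1 m) ⟩
    (suc m C 1) * pfBounded m m + 0
  ≡⟨ +-identityʳ _ ⟩
    (suc m C 1) * pfBounded m m
  ≡⟨ cong₂ _*_ (nC1≡n (suc m)) (cayley m) ⟩
    suc m * suc m ^ (m ∸ 1)
  ≡⟨ n*n^[m∸1]≡n^m m ⟩
    suc m ^ m
  ∎
  where
  open ≡-Reasoning
  n*n^[m∸1]≡n^m : ∀ m → suc m * suc m ^ (m ∸ 1) ≡ suc m ^ m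
  n*n^[m∸1]≡n^m zero    = refl
  n*n^[m∸1]≡n^m (suc m) = refl

partialExpansion : ℕ → ℕ → ℕ → ℕ
partialExpansion n t k = sumBelow (λ j → (n C suc j) * pfBounded (n ∸ suc j) t) k

-- For n = (t+1) + k the expansion of p_{n;=t+1} has k + 1 terms; the last
-- one, k + 1 copies of t + 1 beside a parking function of length t, is given
-- by Cayley's formula.
pEq-lastTerm : ∀ t k n → n ≡ suc t + k →
               pEq n (suc t) ≡ partialExpansion n t k + (n C suc k) * (suc t ^ (t ∸ 1))
pEq-lastTerm t k n n≡1+t+k = begin
    pEq n (suc t)
  ≡⟨ pEq-suc n t t<n ⟩
    sumBelow (λ j → (n C suc j) * pfBounded (n ∸ suc j) t) (n ∸ t)
  ≡⟨ cong (sumBelow (λ j → (n C suc j) * pfBounded (n ∸ suc j) t)) n∸t≡1+k ⟩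
    sumBelow (λ j → (n C suc j) * pfBounded (n ∸ suc j) t) (suc k)
  ≡⟨ sumBelow-snoc (λ j → (n C suc j) * pfBounded (n ∸ suc j) t) k ⟩
    partialExpansion n t k + (n C suc k) * pfBounded (n ∸ suc k) t
  ≡⟨ cong (λ m → partialExpansion n t k + (n C suc k) * pfBounded m t) n∸1+k≡t ⟩
    partialExpansion n t k + (n C suc k) * pfBounded t t
  ≡⟨ cong (λ c → partialExpansion n t k + (n C suc k) * c) (cayley t) ⟩
    partialExpansion n t k + (n C suc k) * (suc t ^ (t ∸ 1))
  ∎
  where
  open ≡-Reasoning
  n≡t+[1+k] : n ≡ t + suc k
  n≡t+[1+k] = trans n≡1+t+k (sym (+-suc t k))
  t<n : t < n
  t<n = subst (t <_) (sym n≡t+[1+k]) (m<m+n t (s≤s z≤n))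
  n∸t≡1+k : n ∸ t ≡ suc k
  n∸t≡1+k = trans (cong (_∸ t) n≡t+[1+k]) (m+n∸m≡n t (suc k))
  n∸1+k≡t : n ∸ suc k ≡ t
  n∸1+k≡t = trans (cong (_∸ suc k) n≡t+[1+k]) (m+n∸n≡m t (suc k))

-- For n = s + k with s = t + 1 and k ≥ 1, each term f(n-j-1, s) of the
-- expansion of p_{n;=s+1} splits by whether s occurs (pfBounded-suc).
pEq-splitTerms : ∀ t k n → 1 ≤ k → n ≡ suc t + k →
                 pEq n (suc (suc t)) ≡ sumBelow (λ j → (n C suc j) * pEq (n ∸ suc j) (suc t)) k
                                       + partialExpansion n t k
pEq-splitTerms t k n 1≤k n≡s+k = begin
    pEq n (suc s)
  ≡⟨ pEq-suc n s s<n ⟩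
    sumBelow (λ j → (n C suc j) * pfBounded (n ∸ suc j) s) (n ∸ s)
  ≡⟨ cong (sumBelow (λ j → (n C suc j) * pfBounded (n ∸ suc j) s)) n∸s≡k ⟩
    sumBelow (λ j → (n C suc j) * pfBounded (n ∸ suc j) s) k
  ≡⟨ sumBelow-cong k (λ j j<k → split j j<k) ⟩
    sumBelow (λ j → (n C suc j) * pEq (n ∸ suc j) s + (n C suc j) * pfBounded (n ∸ suc j) t) k
  ≡⟨ sym (sumBelow-+ (λ j → (n C suc j) * pEq (n ∸ suc j) s) (λ j → (n C suc j) * pfBounded (n ∸ suc j) t) k) ⟩
    sumBelow (λ j → (n C suc j) * pEq (n ∸ suc j) s) k + partialExpansion n t k
  ∎
  where
  open ≡-Reasoning
  s : ℕ
  s = suc t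
  s<n : s < n
  s<n = subst (s <_) (sym n≡s+k) (m<m+n s 1≤k)
  n∸s≡k : n ∸ s ≡ k
  n∸s≡k = trans (cong (_∸ s) n≡s+k) (m+n∸m≡n s k)
  s≤n∸[1+j] : ∀ j → j < k → s ≤ n ∸ suc j
  s≤n∸[1+j] j j<k = subst (_≤ n ∸ suc j) (trans (cong (_∸ k) n≡s+k) (m+n∸n≡m s k)) (∸-monoʳ-≤ n j<k)
  split : ∀ j → j < k → (n C suc j) * pfBounded (n ∸ suc j) s
                        ≡ (n C suc j) * pEq (n ∸ suc j) s + (n C suc j) * pfBounded (n ∸ suc j) t
  split j j<k =
    trans (cong ((n C suc j) *_)
                (trans (pfBounded-suc (n ∸ suc j) t)
                       (cong (_+ pfBounded (n ∸ suc j) t) (sym (pEq≡pfWithMax (n ∸ suc j) s (s≤n∸[1+j] j j<k))))))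
          (*-distribˡ-+ (n C suc j) _ _)

-- Corollary 2.9 over ℕ: with s = n ∸ k ≥ 1, compare the two expansions above;
-- both contain the partial expansion of p_{n;=s}.
pEq-recurrence : ∀ k n → 1 ≤ k → suc k ≤ n →
  pEq n (n ∸ k) + sumBelow (λ j → (n C suc j) * pEq (n ∸ suc j) (n ∸ k)) k
    ≡ pEq n (suc (n ∸ k)) + (n C suc k) * ((n ∸ k) ^ (n ∸ k ∸ 2))
pEq-recurrence k n 1≤k k<n with n ∸ k in n∸k≡s
... | zero  = ⊥-elim (<⇒≱ k<n (m∸n≡0⇒m≤n n∸k≡s))
... | suc t = begin
    pEq n (suc t) + X
  ≡⟨ cong (_+ X) (pEq-lastTerm t k n n≡s+k) ⟩
    (F + C' * suc t ^ (t ∸ 1)) + X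
  ≡⟨ [a+c]+x≡[x+a]+c F (C' * suc t ^ (t ∸ 1)) X ⟩
    (X + F) + C' * suc t ^ (t ∸ 1)
  ≡⟨ cong (_+ C' * suc t ^ (t ∸ 1)) (sym (pEq-splitTerms t k n 1≤k n≡s+k)) ⟩
    pEq n (suc (suc t)) + C' * suc t ^ (t ∸ 1)
  ∎
  where
  open ≡-Reasoning
  C' X F : ℕ
  C' = n C suc k
  X = sumBelow (λ j → (n C suc j) * pEq (n ∸ suc j) (suc t)) k
  F = partialExpansion n t k
  [a+c]+x≡[x+a]+c : ∀ a c x → (a + c) + x ≡ (x + a) + c
  [a+c]+x≡[x+a]+c = solve-∀
  n≡s+k : n ≡ suc t + k
  n≡s+k = trans (sym (m∸n+n≡m (≤-trans (n≤1+n k) k<n))) (cong (_+ k) n∸k≡s)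

open import Data.Integer using (+_; _-_) renaming (_+_ to _+ℤ_)
import Data.Integer.Properties as ℤ

+-move-ℤ : ∀ a b x y → a + x ≡ b + y → + a ≡ (+ b +ℤ + y) - + x
+-move-ℤ a b x y a+x≡b+y = begin
    + a
  ≡⟨ sym (ℤ.+-identityʳ (+ a)) ⟩
    + a +ℤ + 0
  ≡⟨ cong (+ a +ℤ_) (sym (ℤ.+-inverseʳ (+ x))) ⟩
    + a +ℤ (+ x - + x)
  ≡⟨ sym (ℤ.+-assoc (+ a) (+ x) (Data.Integer.- (+ x))) ⟩
    + (a + x) - + x
  ≡⟨ cong (λ z → + z - + x) a+x≡b+y ⟩
    + (b + y) - + x
  ∎
  where open ≡-Reasoning

corollary2p9 :
  ((k n : ℕ) → 1 ≤ k → suc k ≤ n →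
    + pEq n (n ∸ k)
      ≡ (+ pEq n (n ∸ k + 1) +ℤ + ((n C (k + 1)) * ((n ∸ k) ^ (n ∸ k ∸ 2))))
        - + sum (map (λ j → (n C suc j) * pEq (n ∸ suc j) (n ∸ k)) (upTo k)))
  × ((n : ℕ) → 1 ≤ n → pEq n n ≡ n ^ (n ∸ 1))
corollary2p9 = recurrence , pEq-diagonal
  where
  recurrence : (k n : ℕ) → 1 ≤ k → suc k ≤ n →
    + pEq n (n ∸ k)
      ≡ (+ pEq n (n ∸ k + 1) +ℤ + ((n C (k + 1)) * ((n ∸ k) ^ (n ∸ k ∸ 2))))
        - + sum (map (λ j → (n C suc j) * pEq (n ∸ suc j) (n ∸ k)) (upTo k))
  recurrence k n 1≤k k<n rewrite +-comm (n ∸ k) 1 | +-comm k 1 =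
    +-move-ℤ (pEq n (n ∸ k)) (pEq n (suc (n ∸ k))) _ ((n C suc k) * ((n ∸ k) ^ (n ∸ k ∸ 2))) (trans (cong (λ x → pEq n (n ∸ k) + x) (sum-upTo _ k)) (pEq-recurrence k n 1≤k k<n))
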